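{- Let $\Gamma$ be a finite connected graph, let $j\geq 1$, and let $S^1=\{v^1_1,\ldots,v^1_{m_1}\},\ldots,S^j=\{v^j_1,\ldots,v^j_{m_j}\}$ be mutually disjoint subsets of $V(\Gamma)$, each having the conformity property, such that $S^1\cup\cdots\cup S^j\neq V(\Gamma)$. For $1\le i\le j$ and $2\le k\le m_i$ let $e^i_{1k}$ be the class of $v^i_1-v^i_k$ in $\operatorname{Pic}^0(\Gamma)$. If integers $\alpha^i_k$ satisfy $\sum_{i=1}^j\sum_{k=2}^{m_i}\alpha^i_k\, e^i_{1k}=0$ in $\operatorname{Pic}^0(\Gamma)$, then $\alpha^i_k\, e^i_{1k}=0$ in $\operatorname{Pic}^0(\Gamma)$ for every $i$ and $k$.
   Context: A subset $S=\{w_1,\dots,w_m\}\subset V(\Gamma)$ has the conformity property if the induced subgraph on $S$ is either completely disconnected or complete, and for every vertex $x\notin S$ and all $i,j$, $w_ix$ is an edge if and only if $w_jx$ is an edge. $\operatorname{Div}(\Gamma)$ is the free abelian group on $V(\Gamma)$, $\operatorname{Div}^0(\Gamma)$ is the kernel of the degree map $\sum a_v v\mapsto\sum a_v$, the Laplacian $\Delta(\Gamma):\operatorname{Div}(\Gamma)\to\operatorname{Div}^0(\Gamma)$ is given by $v\mapsto(\deg v)\,v-\sum_{wv\in E(\Gamma)}w$, and $\operatorname{Pic}^0(\Gamma)=\operatorname{Div}^0(\Gamma)/\operatorname{im}\Delta(\Gamma)$. -}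

module Defs where

open import Data.Nat using (ℕ; zero; suc)
open import Data.Bool using (Bool; true; false; if_then_else_)
open import Data.Fin using (Fin; _≟_)
import Data.Fin as Fin
open import Data.Integer using (ℤ; +_; _+_; _-_; _*_; 0ℤ; 1ℤ)
open import Data.Product using (Σ; ∃; _×_; _,_)
open import Data.Sum using (_⊎_)
open import Relation.Nullary using (¬_; does)
open import Relation.Binary.PropositionalEquality using (_≡_; _≢_)
open import Relation.Binary.Construct.Closure.ReflexiveTransitive using (Star)

sumℤ : ∀ {n} → (Fin n → ℤ) → ℤ
sumℤ {zero}  f = 0ℤ
sumℤ {suc n} f = f Fin.zero + sumℤ (λ i → f (Fin.suc i))

record Graph (n : ℕ) : Set where
  field
    adj     : Fin n → Fin n → Bool
    sym     : ∀ u v → adj u v ≡ adj v u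
    irrefl  : ∀ v → adj v v ≡ false

open Graph public

Edge : ∀ {n} → Graph n → Fin n → Fin n → Set
Edge Γ u v = adj Γ u v ≡ true

Connected : ∀ {n} → Graph n → Set
Connected Γ = ∀ u v → Star (Edge Γ) u v

-- Divisors: formal ℤ-combinations of vertices.
Div : ℕ → Set
Div n = Fin n → ℤ

δ : ∀ {n} → Fin n → Div n
δ v w = if does (v ≟ w) then 1ℤ else 0ℤ

deg : ∀ {n} → Graph n → Div n → ℤ
deg Γ D = sumℤ D

[_] : Bool → ℤ
[ b ] = if b then 1ℤ else 0ℤ

valency : ∀ {n} → Graph n → Fin n → ℤ
valency Γ v = sumℤ (λ w → [ adj Γ v w ])

-- Laplacian: Δ(Σ f_v v) = Σ_v f_v ((deg v) v - Σ_{wv ∈ E} w);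
-- coefficient at w is  valency(w) f(w) - Σ_{u adjacent to w} f(u).
Δ : ∀ {n} → Graph n → Div n → Div n
Δ Γ f w = valency Γ w * f w - sumℤ (λ u → [ adj Γ w u ] * f u)

-- D (of degree 0) is zero in Pic⁰(Γ) = Div⁰/im Δ  iff  D ∈ im Δ.
IsZeroInPic0 : ∀ {n} → Graph n → Div n → Set
IsZeroInPic0 Γ D = (deg Γ D ≡ 0ℤ) × ∃ λ f → ∀ w → D w ≡ Δ Γ f w

_⊕_ : ∀ {n} → Div n → Div n → Div n
(D ⊕ E) w = D w + E w

_⊖_ : ∀ {n} → Div n → Div n → Div n
(D ⊖ E) w = D w - E w

_·_ : ∀ {n} → ℤ → Div n → Div n
(a · D) w = a * D w

zeroDiv : ∀ {n} → Div n
zeroDiv w = 0ℤ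

sumDiv : ∀ {n m} → (Fin m → Div n) → Div n
sumDiv F w = sumℤ (λ i → F i w)

InS : ∀ {n m} → (Fin m → Fin n) → Fin n → Set
InS s x = ∃ λ a → s a ≡ x

Conformity : ∀ {n m} → Graph n → (Fin m → Fin n) → Set
Conformity Γ s =
  ((∀ a b → a ≢ b → adj Γ (s a) (s b) ≡ true) ⊎ (∀ a b → adj Γ (s a) (s b) ≡ false))
  × (∀ x → ¬ InS s x → ∀ a b → adj Γ (s a) x ≡ adj Γ (s b) x)

module Submission where

-- For a set S = {s₀, …, s_m} with the conformity property, any two
-- of its vertices are twins (same neighbours outside the pair), so every
-- difference s₀ - s_k is an eigenvector of the Laplacian with one common
-- eigenvalue c_S = deg s₀ + [S is complete] ≥ 1.  Hence the block divisor
-- D_S = Σ_k α_k (s₀ - s_k) satisfies Δ D_S = c_S D_S.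
-- Now suppose Σ_i D_i = Δ f.  Choose a common multiple C = Q_i c_i (Q_i ≠ 0) of
-- the eigenvalues; then ψ = C f - Σ_i Q_i D_i is harmonic, so by the maximum
-- principle it is constant on the connected graph.  Comparing ψ at a vertex x
-- outside all blocks with ψ at s^i_k gives α^i_k = c_i (f x - f s^i_k), and
-- therefore α^i_k (s^i_0 - s^i_k) = Δ ((f x - f s^i_k)(s^i_0 - s^i_k)).

open import Defs
open import Data.Nat using (ℕ; suc; _≤_)
open import Data.Fin using (Fin; zero; suc)
open import Data.Integer using (ℤ)
open import Data.Product using (Σ; ∃; _×_; _,_)
open import Relation.Nullary using (¬_)
open import Relation.Binary.PropositionalEquality using (_≡_; _≢_)

open import Data.Nat using (z≤n)
open import Data.Product using (proj₁; proj₂)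
open import Function using (_∘_)
open import Data.Bool using (true; false)
open import Data.Sum using (inj₁; inj₂)
open import Data.Empty using (⊥-elim)
open import Data.Integer using (+_; 0ℤ; 1ℤ; -_; _+_; _*_; _-_; +≤+)
import Data.Integer as ℤ
import Data.Integer.Properties as ℤ
open import Data.Integer.Tactic.RingSolver using (solve-∀)
import Data.Fin as Fin
import Data.Fin.Properties as Fin
open import Relation.Nullary using (yes; no)
open import Relation.Nullary.Decidable using (dec-true; dec-false)
open import Relation.Binary.PropositionalEquality as ≡ using (refl; cong; cong₂; trans)
open ≡.≡-Reasoning
open import Relation.Binary.Construct.Closure.ReflexiveTransitive using (Star; ε; _◅_)
open import Data.List using (allFin)
import Data.List.Relation.Unary.All as All
open import Data.List.Membership.Propositional.Properties using (∈-allFin)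
open import Data.List.Extrema ℤ.≤-totalOrder using (argmax; f[xs]≤f[argmax])
open import Algebra.Properties.Ring ℤ.+-*-ring using (x[y-z]≈xy-xz)
open import Algebra.Properties.Semiring.Sum ℤ.+-*-semiring
  using (sum; sum-cong-≗; sum-replicate-zero; sum-remove; ∑-distrib-+; ∑-comm; *-distribˡ-sum)

sumℤ≡sum : ∀ {n} (f : Fin n → ℤ) → sumℤ f ≡ sum f
sumℤ≡sum {ℕ.zero} f = refl
sumℤ≡sum {suc n}  f = cong (_+_ (f zero)) (sumℤ≡sum (f ∘ suc))

sum-cong : ∀ {n} {f g : Fin n → ℤ} → (∀ i → f i ≡ g i) → sumℤ f ≡ sumℤ g
sum-cong {f = f} {g} f≗g = trans (sumℤ≡sum f) (trans (sum-cong-≗ f≗g) (≡.sym (sumℤ≡sum g)))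

sum-+ : ∀ {n} (f g : Fin n → ℤ) → sumℤ (λ i → f i + g i) ≡ sumℤ f + sumℤ g
sum-+ f g rewrite sumℤ≡sum (λ i → f i + g i) | sumℤ≡sum f | sumℤ≡sum g = ∑-distrib-+ f g

sum-* : ∀ {n} (a : ℤ) (f : Fin n → ℤ) → sumℤ (λ i → a * f i) ≡ a * sumℤ f
sum-* a f rewrite sumℤ≡sum (λ i → a * f i) | sumℤ≡sum f = ≡.sym (*-distribˡ-sum a f)

sum-neg : ∀ {n} (f : Fin n → ℤ) → sumℤ (λ i → - f i) ≡ - sumℤ f
sum-neg {ℕ.zero} f = refl
sum-neg {suc n}  f =
  trans (cong (_+_ (- f zero)) (sum-neg (f ∘ suc))) (≡.sym (ℤ.neg-distrib-+ (f zero) _))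

sum-- : ∀ {n} (f g : Fin n → ℤ) → sumℤ (λ i → f i - g i) ≡ sumℤ f - sumℤ g
sum-- f g = trans (sum-+ f (λ i → - g i)) (cong (_+_ (sumℤ f)) (sum-neg g))

sum-swap : ∀ {n k} (h : Fin n → Fin k → ℤ) →
  sumℤ (λ u → sumℤ (h u)) ≡ sumℤ (λ i → sumℤ (λ u → h u i))
sum-swap h = begin
  sumℤ (λ u → sumℤ (h u))          ≡⟨ sumℤ≡sum (λ u → sumℤ (h u)) ⟩
  sum (λ u → sumℤ (h u))           ≡⟨ sum-cong-≗ (λ u → sumℤ≡sum (h u)) ⟩
  sum (λ u → sum (h u))            ≡⟨ ∑-comm h ⟩
  sum (λ i → sum (λ u → h u i))    ≡⟨ sum-cong-≗ (λ i → sumℤ≡sum (λ u → h u i)) ⟨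
  sum (λ i → sumℤ (λ u → h u i))   ≡⟨ sumℤ≡sum (λ i → sumℤ (λ u → h u i)) ⟨
  sumℤ (λ i → sumℤ (λ u → h u i))  ∎

sum-zero : ∀ {n} {f : Fin n → ℤ} → (∀ i → f i ≡ 0ℤ) → sumℤ f ≡ 0ℤ
sum-zero {n} f≡0 = trans (sum-cong f≡0) (trans (sumℤ≡sum {n} (λ _ → 0ℤ)) (sum-replicate-zero n))

sum-single : ∀ {n} (f : Fin n → ℤ) (i : Fin n) → (∀ i′ → i′ ≢ i → f i′ ≡ 0ℤ) → sumℤ f ≡ f i
sum-single {suc n} f i vanish = begin
  sumℤ f                          ≡⟨ sumℤ≡sum f ⟩
  sum f                           ≡⟨ sum-remove f ⟩
  f i + sum (f ∘ Fin.punchIn i)   ≡⟨ cong (_+_ (f i)) rest≡0 ⟩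
  f i + 0ℤ                        ≡⟨ ℤ.+-identityʳ (f i) ⟩
  f i                             ∎
  where
  rest≡0 : sum (f ∘ Fin.punchIn i) ≡ 0ℤ
  rest≡0 = trans (≡.sym (sumℤ≡sum (f ∘ Fin.punchIn i))) (sum-zero (λ k → vanish _ (Fin.punchInᵢ≢i i k)))

nonneg-+-zero : ∀ {a b} → 0ℤ ℤ.≤ a → 0ℤ ℤ.≤ b → a + b ≡ 0ℤ → a ≡ 0ℤ × b ≡ 0ℤ
nonneg-+-zero {+ ℕ.zero}  {+ ℕ.zero}  _ _ _  = refl , refl
nonneg-+-zero {+ ℕ.zero}  {+ suc _} _ _ ()
nonneg-+-zero {+ suc _} {+ _}     _ _ ()

sum-nonneg : ∀ {n} (f : Fin n → ℤ) → (∀ i → 0ℤ ℤ.≤ f i) → 0ℤ ℤ.≤ sumℤ f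
sum-nonneg {ℕ.zero} f f≥0 = ℤ.≤-refl
sum-nonneg {suc n}  f f≥0 = ℤ.+-mono-≤ (f≥0 zero) (sum-nonneg (f ∘ suc) (f≥0 ∘ suc))

nonneg-sum-zero : ∀ {n} (f : Fin n → ℤ) → (∀ i → 0ℤ ℤ.≤ f i) → sumℤ f ≡ 0ℤ → ∀ i → f i ≡ 0ℤ
nonneg-sum-zero {suc n} f f≥0 Σf≡0 i
  with nonneg-+-zero (f≥0 zero) (sum-nonneg (f ∘ suc) (f≥0 ∘ suc)) Σf≡0
... | f₀≡0 , rest≡0 with i
...   | zero  = f₀≡0
...   | suc i = nonneg-sum-zero (f ∘ suc) (f≥0 ∘ suc) rest≡0 i

bracket-nonneg : ∀ b → 0ℤ ℤ.≤ [ b ]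
bracket-nonneg true  = +≤+ z≤n
bracket-nonneg false = +≤+ z≤n

bracket-*-nonneg : ∀ b {x} → 0ℤ ℤ.≤ x → 0ℤ ℤ.≤ [ b ] * x
bracket-*-nonneg true  {x} x≥0 = ≡.subst (0ℤ ℤ.≤_) (≡.sym (ℤ.*-identityˡ x)) x≥0
bracket-*-nonneg false     _   = ℤ.≤-refl

δ-same : ∀ {n} (a : Fin n) → δ a a ≡ 1ℤ
δ-same a rewrite dec-true (a Fin.≟ a) refl = refl

δ-diff : ∀ {n} {a w : Fin n} → a ≢ w → δ a w ≡ 0ℤ
δ-diff {a = a} {w} a≢w rewrite dec-false (a Fin.≟ w) a≢w = refl

δ-weight : ∀ {n} (g : Fin n → ℤ) (a w : Fin n) → g w * δ a w ≡ g a * δ a w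
δ-weight g a w with a Fin.≟ w
... | yes refl = refl
... | no _ = trans (ℤ.*-zeroʳ (g w)) (≡.sym (ℤ.*-zeroʳ (g a)))

sum-δ : ∀ {n} (g : Fin n → ℤ) (a : Fin n) → sumℤ (λ u → g u * δ a u) ≡ g a
sum-δ g a = begin
  sumℤ (λ u → g u * δ a u)  ≡⟨ sum-single _ a off-a ⟩
  g a * δ a a               ≡⟨ cong (g a *_) (δ-same a) ⟩
  g a * 1ℤ                  ≡⟨ ℤ.*-identityʳ (g a) ⟩
  g a                       ∎
  where
  off-a : ∀ u → u ≢ a → g u * δ a u ≡ 0ℤ
  off-a u u≢a = trans (cong (g u *_) (δ-diff (u≢a ∘ ≡.sym))) (ℤ.*-zeroʳ (g u))

deg-δ : ∀ {n} (a : Fin n) → sumℤ (δ a) ≡ 1ℤ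
deg-δ a = trans (sum-cong (λ u → ≡.sym (ℤ.*-identityˡ (δ a u)))) (sum-δ (λ _ → 1ℤ) a)

deg-δ-difference : ∀ {n} (Γ : Graph n) (a b : Fin n) → deg Γ (δ a ⊖ δ b) ≡ 0ℤ
deg-δ-difference Γ a b = begin
  sumℤ (λ w → δ a w - δ b w)  ≡⟨ sum-- (δ a) (δ b) ⟩
  sumℤ (δ a) - sumℤ (δ b)     ≡⟨ cong₂ _-_ (deg-δ a) (deg-δ b) ⟩
  1ℤ - 1ℤ                     ≡⟨⟩
  0ℤ                          ∎

negate-both-sides : ∀ {a} c p q → - a ≡ c * (p - q) → a ≡ c * (q - p)
negate-both-sides {a} c p q e = begin
  a                  ≡⟨ ℤ.neg-involutive a ⟨
  - (- a)            ≡⟨ cong -_ e ⟩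
  - (c * (p - q))    ≡⟨ flip-sign c p q ⟩
  c * (q - p)        ∎
  where
  flip-sign : ∀ c p q → - (c * (p - q)) ≡ c * (q - p)
  flip-sign = solve-∀

*-nonzero : ∀ {a b} → a ≢ 0ℤ → b ≢ 0ℤ → a * b ≢ 0ℤ
*-nonzero {a} a≢0 b≢0 ab≡0 with ℤ.i*j≡0⇒i≡0∨j≡0 a ab≡0
... | inj₁ a≡0 = a≢0 a≡0
... | inj₂ b≡0 = b≢0 b≡0

*-cancelˡ-nonzero : ∀ {q a b} → q ≢ 0ℤ → q * a ≡ q * b → a ≡ b
*-cancelˡ-nonzero {q} {a} {b} q≢0 = ℤ.*-cancelˡ-≡ q a b {{ℤ.≢-nonZero q≢0}}

-- C ≠ 0 is kept as a field so that the induction can use it as the new cofactor.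
record CommonMultiple {j} (c : Fin j → ℤ) : Set where
  field
    C             : ℤ
    cofactor      : Fin j → ℤ
    C≢0           : C ≢ 0ℤ
    cofactor≢0    : ∀ i → cofactor i ≢ 0ℤ
    cofactor-spec : ∀ i → cofactor i * c i ≡ C

common-multiple : ∀ {j} (c : Fin j → ℤ) → (∀ i → c i ≢ 0ℤ) → CommonMultiple c
common-multiple {ℕ.zero} c _ = record
  { C = 1ℤ ; cofactor = λ () ; C≢0 = λ () ; cofactor≢0 = λ () ; cofactor-spec = λ () }
common-multiple {suc j} c c≢0 = record
  { C             = c zero * C′
  ; cofactor      = Q
  ; C≢0           = *-nonzero (c≢0 zero) C′≢0
  ; cofactor≢0    = Q≢0
  ; cofactor-spec = Qc≡C
  }
  where
  open CommonMultiple (common-multiple (c ∘ suc) (c≢0 ∘ suc))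
    renaming (C to C′; cofactor to Q′; C≢0 to C′≢0; cofactor≢0 to Q′≢0; cofactor-spec to Q′c≡C′)
  Q : Fin (suc j) → ℤ
  Q zero    = C′
  Q (suc i) = c zero * Q′ i
  Q≢0 : ∀ i → Q i ≢ 0ℤ
  Q≢0 zero    = C′≢0
  Q≢0 (suc i) = *-nonzero (c≢0 zero) (Q′≢0 i)
  Qc≡C : ∀ i → Q i * c i ≡ c zero * C′
  Qc≡C zero    = ℤ.*-comm C′ (c zero)
  Qc≡C (suc i) = trans (ℤ.*-assoc (c zero) (Q′ i) (c (suc i))) (cong (_*_ (c zero)) (Q′c≡C′ i))

blockDiv : ∀ {n m} → (Fin (suc m) → Fin n) → (Fin m → ℤ) → Div n
blockDiv s α = sumDiv (λ k → α k · (δ (s zero) ⊖ δ (s (suc k))))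

first≢rest : ∀ {n m} {s : Fin (suc m) → Fin n} → (∀ a b → s a ≡ s b → a ≡ b) → ∀ k → s zero ≢ s (suc k)
first≢rest s-inj k e with s-inj zero (suc k) e
... | ()

blockDiv-outside : ∀ {n m} (s : Fin (suc m) → Fin n) (α : Fin m → ℤ) {w} →
  (∀ a → s a ≢ w) → blockDiv s α w ≡ 0ℤ
blockDiv-outside s α outside = sum-zero (λ k →
  trans (cong (_*_ (α k)) (cong₂ _-_ (δ-diff (outside zero)) (δ-diff (outside (suc k))))) (ℤ.*-zeroʳ (α k)))

blockDiv-at : ∀ {n m} {s : Fin (suc m) → Fin n} → (∀ a b → s a ≡ s b → a ≡ b) →
  (α : Fin m → ℤ) → ∀ k → blockDiv s α (s (suc k)) ≡ - α k
blockDiv-at {s = s} s-inj α k = begin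
  blockDiv s α (s (suc k))                                     ≡⟨ sum-single _ k other-terms ⟩
  α k * (δ (s zero) (s (suc k)) - δ (s (suc k)) (s (suc k)))   ≡⟨ cong₂ (λ p q → α k * (p - q)) (δ-diff (first≢rest s-inj k)) (δ-same (s (suc k))) ⟩
  α k * (0ℤ - 1ℤ)                                              ≡⟨ times-minus-one (α k) ⟩
  - α k                                                        ∎
  where
  times-minus-one : ∀ a → a * (0ℤ - 1ℤ) ≡ - a
  times-minus-one = solve-∀
  other-terms : ∀ k′ → k′ ≢ k → α k′ * (δ (s zero) (s (suc k)) - δ (s (suc k′)) (s (suc k))) ≡ 0ℤ
  other-terms k′ k′≢k = trans
    (cong₂ (λ p q → α k′ * (p - q)) (δ-diff (first≢rest s-inj k))
           (δ-diff (λ e → k′≢k (Fin.suc-injective (s-inj (suc k′) (suc k) e)))))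
    (ℤ.*-zeroʳ (α k′))

module _ {n} (Γ : Graph n) where

  Δ-⊖ : (D E : Div n) → ∀ w → Δ Γ (D ⊖ E) w ≡ Δ Γ D w - Δ Γ E w
  Δ-⊖ D E w = begin
    V * (D w - E w) - sumℤ (λ u → [ adj Γ w u ] * (D u - E u))
      ≡⟨ cong (_-_ (V * (D w - E w))) (trans (sum-cong distrib) (sum-- ND NE)) ⟩
    V * (D w - E w) - (sumℤ ND - sumℤ NE)
      ≡⟨ regroup V (D w) (E w) (sumℤ ND) (sumℤ NE) ⟩
    (V * D w - sumℤ ND) - (V * E w - sumℤ NE)
      ∎
    where
    V : ℤ
    V = valency Γ w
    ND NE : Fin n → ℤ
    ND u = [ adj Γ w u ] * D u
    NE u = [ adj Γ w u ] * E u
    distrib : ∀ u → [ adj Γ w u ] * (D u - E u) ≡ ND u - NE u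
    distrib u = x[y-z]≈xy-xz [ adj Γ w u ] (D u) (E u)
    regroup : ∀ v d e s t → v * (d - e) - (s - t) ≡ (v * d - s) - (v * e - t)
    regroup = solve-∀

  Δ-· : (a : ℤ) (D : Div n) → ∀ w → Δ Γ (a · D) w ≡ a * Δ Γ D w
  Δ-· a D w = begin
    V * (a * D w) - sumℤ (λ u → [ adj Γ w u ] * (a * D u))
      ≡⟨ cong (_-_ (V * (a * D w))) (trans (sum-cong (λ u → commute [ adj Γ w u ] a (D u))) (sum-* a ND)) ⟩
    V * (a * D w) - a * sumℤ ND
      ≡⟨ factor V a (D w) (sumℤ ND) ⟩
    a * (V * D w - sumℤ ND)
      ∎
    where
    V : ℤ
    V = valency Γ w
    ND : Fin n → ℤ
    ND u = [ adj Γ w u ] * D u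
    commute : ∀ x a y → x * (a * y) ≡ a * (x * y)
    commute = solve-∀
    factor : ∀ v a d s → v * (a * d) - a * s ≡ a * (v * d - s)
    factor = solve-∀

  Δ-sumDiv : ∀ {k} (F : Fin k → Div n) → ∀ w → Δ Γ (sumDiv F) w ≡ sumℤ (λ i → Δ Γ (F i) w)
  Δ-sumDiv F w = begin
    V * sumℤ (λ i → F i w) - sumℤ (λ u → [ adj Γ w u ] * sumℤ (λ i → F i u))
      ≡⟨ cong₂ _-_ (≡.sym (sum-* V (λ i → F i w))) neighbours ⟩
    sumℤ (λ i → V * F i w) - sumℤ (λ i → sumℤ (λ u → [ adj Γ w u ] * F i u))
      ≡⟨ sum-- (λ i → V * F i w) (λ i → sumℤ (λ u → [ adj Γ w u ] * F i u)) ⟨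
    sumℤ (λ i → Δ Γ (F i) w)
      ∎
    where
    V : ℤ
    V = valency Γ w
    neighbours : sumℤ (λ u → [ adj Γ w u ] * sumℤ (λ i → F i u))
               ≡ sumℤ (λ i → sumℤ (λ u → [ adj Γ w u ] * F i u))
    neighbours = trans (sum-cong (λ u → ≡.sym (sum-* [ adj Γ w u ] (λ i → F i u))))
                       (sum-swap (λ u i → [ adj Γ w u ] * F i u))

  Δ-δ : ∀ a w → Δ Γ (δ a) w ≡ valency Γ w * δ a w - [ adj Γ w a ]
  Δ-δ a w = cong (_-_ (valency Γ w * δ a w)) (sum-δ (λ u → [ adj Γ w u ]) a)

  Twins : Fin n → Fin n → Set
  Twins a b = ∀ w → w ≢ a → w ≢ b → adj Γ a w ≡ adj Γ b w

  twin-neighbours : ∀ {a b} → a ≢ b → Twins a b →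
    ∀ w → [ adj Γ a w ] - [ adj Γ b w ] ≡ [ adj Γ a b ] * (δ b w - δ a w)
  twin-neighbours {a} {b} a≢b twins w with w Fin.≟ a | w Fin.≟ b
  ... | yes refl | yes refl = ⊥-elim (a≢b refl)
  ... | yes refl | no _
    rewrite irrefl Γ a | sym Γ b a | δ-same a | δ-diff (a≢b ∘ ≡.sym) = at-a [ adj Γ a b ]
    where at-a : ∀ x → 0ℤ - x ≡ x * (0ℤ - 1ℤ)
          at-a = solve-∀
  ... | no _ | yes refl
    rewrite irrefl Γ b | δ-same b | δ-diff a≢b = at-b [ adj Γ a b ]
    where at-b : ∀ x → x - 0ℤ ≡ x * (1ℤ - 0ℤ)
          at-b = solve-∀
  ... | no w≢a | no w≢b
    rewrite twins w w≢a w≢b | δ-diff (w≢a ∘ ≡.sym) | δ-diff (w≢b ∘ ≡.sym) = elsewhere [ adj Γ b w ] [ adj Γ a b ]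
    where elsewhere : ∀ x y → x - x ≡ y * (0ℤ - 0ℤ)
          elsewhere = solve-∀

  valency-twins : ∀ {a b} → a ≢ b → Twins a b → valency Γ a ≡ valency Γ b
  valency-twins {a} {b} a≢b twins = ℤ.i-j≡0⇒i≡j _ _ (begin
    valency Γ a - valency Γ b                      ≡⟨ sum-- (λ w → [ adj Γ a w ]) (λ w → [ adj Γ b w ]) ⟨
    sumℤ (λ w → [ adj Γ a w ] - [ adj Γ b w ])     ≡⟨ sum-cong (twin-neighbours a≢b twins) ⟩
    sumℤ (λ w → [ adj Γ a b ] * (δ b w - δ a w))   ≡⟨ sum-* [ adj Γ a b ] (λ w → δ b w - δ a w) ⟩
    [ adj Γ a b ] * sumℤ (λ w → δ b w - δ a w)     ≡⟨ cong (_*_ [ adj Γ a b ]) (deg-δ-difference Γ b a) ⟩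
    [ adj Γ a b ] * 0ℤ                             ≡⟨ ℤ.*-zeroʳ [ adj Γ a b ] ⟩
    0ℤ                                             ∎)

  Δ-twins : ∀ {a b} → a ≢ b → Twins a b →
    ∀ w → Δ Γ (δ a ⊖ δ b) w ≡ (valency Γ a + [ adj Γ a b ]) * (δ a w - δ b w)
  Δ-twins {a} {b} a≢b twins w = begin
    Δ Γ (δ a ⊖ δ b) w
      ≡⟨ Δ-⊖ (δ a) (δ b) w ⟩
    Δ Γ (δ a) w - Δ Γ (δ b) w
      ≡⟨ cong₂ _-_ (Δ-δ a w) (Δ-δ b w) ⟩
    (valency Γ w * δ a w - [ adj Γ w a ]) - (valency Γ w * δ b w - [ adj Γ w b ])
      ≡⟨ cong₂ (λ p q → (p - [ adj Γ w a ]) - (q - [ adj Γ w b ]))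
               (δ-weight (valency Γ) a w)
               (trans (δ-weight (valency Γ) b w) (cong (_* δ b w) (≡.sym (valency-twins a≢b twins)))) ⟩
    (V * δ a w - [ adj Γ w a ]) - (V * δ b w - [ adj Γ w b ])
      ≡⟨ cong₂ (λ p q → (V * δ a w - [ p ]) - (V * δ b w - [ q ])) (sym Γ w a) (sym Γ w b) ⟩
    (V * δ a w - [ adj Γ a w ]) - (V * δ b w - [ adj Γ b w ])
      ≡⟨ regroup V (δ a w) (δ b w) [ adj Γ a w ] [ adj Γ b w ] ⟩
    V * (δ a w - δ b w) - ([ adj Γ a w ] - [ adj Γ b w ])
      ≡⟨ cong (_-_ (V * (δ a w - δ b w))) (twin-neighbours a≢b twins w) ⟩
    V * (δ a w - δ b w) - [ adj Γ a b ] * (δ b w - δ a w)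
      ≡⟨ collect V [ adj Γ a b ] (δ a w) (δ b w) ⟩
    (V + [ adj Γ a b ]) * (δ a w - δ b w)
      ∎
    where
    V : ℤ
    V = valency Γ a
    regroup : ∀ v p q x y → (v * p - x) - (v * q - y) ≡ v * (p - q) - (x - y)
    regroup = solve-∀
    collect : ∀ v κ p q → v * (p - q) - κ * (q - p) ≡ (v + κ) * (p - q)
    collect = solve-∀

  conformity-twins : ∀ {m} {s : Fin m → Fin n} → Conformity Γ s → ∀ a b → Twins (s a) (s b)
  conformity-twins {s = s} (inside , outside) a b w w≢sa w≢sb with Fin.any? (λ c → s c Fin.≟ w)
  ... | no w∉S = outside w w∉S a b
  ... | yes (c , refl) with inside
  ...   | inj₁ complete =
    trans (complete a c (λ a≡c → w≢sa (cong s (≡.sym a≡c))))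
          (≡.sym (complete b c (λ b≡c → w≢sb (cong s (≡.sym b≡c)))))
  ...   | inj₂ independent = trans (independent a c) (≡.sym (independent b c))

  blockWeight : ∀ {m} {s : Fin m → Fin n} → Conformity Γ s → ℤ
  blockWeight (inj₁ _ , _) = 1ℤ
  blockWeight (inj₂ _ , _) = 0ℤ

  blockWeight-adj : ∀ {m} {s : Fin m → Fin n} (conf : Conformity Γ s) →
    ∀ {a b} → a ≢ b → [ adj Γ (s a) (s b) ] ≡ blockWeight conf
  blockWeight-adj (inj₁ complete , _)    a≢b = cong [_] (complete _ _ a≢b)
  blockWeight-adj (inj₂ independent , _) _   = cong [_] (independent _ _)

  blockWeight-nonneg : ∀ {m} {s : Fin m → Fin n} (conf : Conformity Γ s) → 0ℤ ℤ.≤ blockWeight conf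
  blockWeight-nonneg (inj₁ _ , _) = +≤+ z≤n
  blockWeight-nonneg (inj₂ _ , _) = +≤+ z≤n

  blockEigenvalue : ∀ {m} {s : Fin (suc m) → Fin n} → Conformity Γ s → ℤ
  blockEigenvalue {s = s} conf = valency Γ (s zero) + blockWeight conf

  Δ-block-difference : ∀ {m} {s : Fin (suc m) → Fin n} → (∀ a b → s a ≡ s b → a ≡ b) →
    (conf : Conformity Γ s) → ∀ k w →
    Δ Γ (δ (s zero) ⊖ δ (s (suc k))) w ≡ blockEigenvalue conf * (δ (s zero) w - δ (s (suc k)) w)
  Δ-block-difference {s = s} s-inj conf k w =
    trans (Δ-twins (first≢rest s-inj k) (conformity-twins conf zero (suc k)) w)
          (cong (λ κ → (valency Γ (s zero) + κ) * (δ (s zero) w - δ (s (suc k)) w))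
                (blockWeight-adj conf (λ ())))

  Δ-blockDiv : ∀ {m} {s : Fin (suc m) → Fin n} → (∀ a b → s a ≡ s b → a ≡ b) →
    (conf : Conformity Γ s) (α : Fin m → ℤ) →
    ∀ w → Δ Γ (blockDiv s α) w ≡ blockEigenvalue conf * blockDiv s α w
  Δ-blockDiv {m} {s} s-inj conf α w = begin
    Δ Γ (blockDiv s α) w                 ≡⟨ Δ-sumDiv (λ k → α k · E k) w ⟩
    sumℤ (λ k → Δ Γ (α k · E k) w)       ≡⟨ sum-cong term ⟩
    sumℤ (λ k → c * (α k * E k w))       ≡⟨ sum-* c (λ k → α k * E k w) ⟩
    c * blockDiv s α w                   ∎
    where
    c : ℤ
    c = blockEigenvalue conf
    E : Fin m → Div n
    E k = δ (s zero) ⊖ δ (s (suc k))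
    commute : ∀ a c e → a * (c * e) ≡ c * (a * e)
    commute = solve-∀
    term : ∀ k → Δ Γ (α k · E k) w ≡ c * (α k * E k w)
    term k = trans (Δ-· (α k) (E k) w)
                   (trans (cong (_*_ (α k)) (Δ-block-difference s-inj conf k w)) (commute (α k) c (E k w)))

  valency-nonneg : ∀ u → 0ℤ ℤ.≤ valency Γ u
  valency-nonneg u = sum-nonneg (λ w → [ adj Γ u w ]) (λ w → bracket-nonneg (adj Γ u w))

  blockEigenvalue-nonzero : ∀ {m} {s : Fin (suc m) → Fin n} (conf : Conformity Γ s) →
    ∀ {y} → Edge Γ (s zero) y → blockEigenvalue conf ≢ 0ℤ
  blockEigenvalue-nonzero {s = s} conf {y} edge c≡0 = 1≢0 (begin
    1ℤ                     ≡⟨ cong [_] edge ⟨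
    [ adj Γ (s zero) y ]   ≡⟨ nonneg-sum-zero _ (λ w → bracket-nonneg (adj Γ (s zero) w)) valency≡0 y ⟩
    0ℤ                     ∎)
    where
    valency≡0 : valency Γ (s zero) ≡ 0ℤ
    valency≡0 = proj₁ (nonneg-+-zero (valency-nonneg (s zero)) (blockWeight-nonneg conf) c≡0)
    1≢0 : 1ℤ ≢ 0ℤ
    1≢0 ()

  has-neighbour : ∀ {u y} → Star (Edge Γ) u y → u ≢ y → ∃ λ w → Edge Γ u w
  has-neighbour ε                      u≢u = ⊥-elim (u≢u refl)
  has-neighbour (_◅_ {j = w} edge _) _   = w , edge

  Δ-as-differences : (ψ : Div n) → ∀ u → Δ Γ ψ u ≡ sumℤ (λ w → [ adj Γ u w ] * (ψ u - ψ w))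
  Δ-as-differences ψ u = begin
    valency Γ u * ψ u - sumℤ (λ w → [ adj Γ u w ] * ψ w)
      ≡⟨ cong (_- sumℤ (λ w → [ adj Γ u w ] * ψ w)) valency-scaled ⟩
    sumℤ (λ w → [ adj Γ u w ] * ψ u) - sumℤ (λ w → [ adj Γ u w ] * ψ w)
      ≡⟨ sum-- (λ w → [ adj Γ u w ] * ψ u) (λ w → [ adj Γ u w ] * ψ w) ⟨
    sumℤ (λ w → [ adj Γ u w ] * ψ u - [ adj Γ u w ] * ψ w)
      ≡⟨ sum-cong (λ w → x[y-z]≈xy-xz [ adj Γ u w ] (ψ u) (ψ w)) ⟨
    sumℤ (λ w → [ adj Γ u w ] * (ψ u - ψ w))
      ∎
    where
    valency-scaled : valency Γ u * ψ u ≡ sumℤ (λ w → [ adj Γ u w ] * ψ u)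
    valency-scaled = begin
      valency Γ u * ψ u                    ≡⟨ ℤ.*-comm (valency Γ u) (ψ u) ⟩
      ψ u * valency Γ u                    ≡⟨ sum-* (ψ u) (λ w → [ adj Γ u w ]) ⟨
      sumℤ (λ w → ψ u * [ adj Γ u w ])     ≡⟨ sum-cong (λ w → ℤ.*-comm (ψ u) [ adj Γ u w ]) ⟩
      sumℤ (λ w → [ adj Γ u w ] * ψ u)     ∎

  harmonic-at-max : (ψ : Div n) → ∀ u → (∀ w → ψ w ℤ.≤ ψ u) → Δ Γ ψ u ≡ 0ℤ →
    ∀ w → Edge Γ u w → ψ w ≡ ψ u
  harmonic-at-max ψ u max harmonic w edge = ≡.sym (ℤ.i-j≡0⇒i≡j (ψ u) (ψ w) (begin
    ψ u - ψ w                             ≡⟨ ℤ.*-identityˡ (ψ u - ψ w) ⟨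
    [ true ] * (ψ u - ψ w)                ≡⟨ cong (λ b → [ b ] * (ψ u - ψ w)) edge ⟨
    [ adj Γ u w ] * (ψ u - ψ w)           ≡⟨ nonneg-sum-zero _ terms≥0 (trans (≡.sym (Δ-as-differences ψ u)) harmonic) w ⟩
    0ℤ                                    ∎))
    where
    terms≥0 : ∀ w → 0ℤ ℤ.≤ [ adj Γ u w ] * (ψ u - ψ w)
    terms≥0 w = bracket-*-nonneg (adj Γ u w) (ℤ.i≤j⇒0≤j-i (max w))

  harmonic-constant : Connected Γ → (ψ : Div n) → (∀ w → Δ Γ ψ w ≡ 0ℤ) → ∀ u w → ψ u ≡ ψ w
  harmonic-constant conn ψ harmonic u w = trans (spread (conn top u) refl) (≡.sym (spread (conn top w) refl))
    where
    top : Fin n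
    top = argmax ψ u (allFin n)
    is-max : ∀ w → ψ w ℤ.≤ ψ top
    is-max w = All.lookup (f[xs]≤f[argmax] u (allFin n)) (∈-allFin w)
    spread : ∀ {a y} → Star (Edge Γ) a y → ψ a ≡ ψ top → ψ y ≡ ψ top
    spread ε                           ψa≡max = ψa≡max
    spread (_◅_ {i = a} {j = b} edge path) ψa≡max =
      spread path (trans (harmonic-at-max ψ a a-max (harmonic a) b edge) ψa≡max)
      where
      a-max : ∀ w → ψ w ℤ.≤ ψ a
      a-max w = ≡.subst (ψ w ℤ.≤_) (≡.sym ψa≡max) (is-max w)

  combination-harmonic : ∀ {j} (D : Fin j → Div n) (c : Fin j → ℤ) →
    (∀ i w → Δ Γ (D i) w ≡ c i * D i w) →
    (f : Div n) → (∀ w → sumDiv D w ≡ Δ Γ f w) →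
    (C : ℤ) (Q : Fin j → ℤ) → (∀ i → Q i * c i ≡ C) →
    ∀ w → Δ Γ ((C · f) ⊖ sumDiv (λ i → Q i · D i)) w ≡ 0ℤ
  combination-harmonic {j} D c eigen f Σ≡Δf C Q QC w = begin
    Δ Γ ((C · f) ⊖ sumDiv QD) w
      ≡⟨ Δ-⊖ (C · f) (sumDiv QD) w ⟩
    Δ Γ (C · f) w - Δ Γ (sumDiv QD) w
      ≡⟨ cong₂ _-_ (Δ-· C f w) (Δ-sumDiv QD w) ⟩
    C * Δ Γ f w - sumℤ (λ i → Δ Γ (QD i) w)
      ≡⟨ cong₂ _-_ (cong (_*_ C) (≡.sym (Σ≡Δf w))) (sum-cong term) ⟩
    C * sumDiv D w - sumℤ (λ i → C * D i w)
      ≡⟨ cong (_-_ (C * sumDiv D w)) (sum-* C (λ i → D i w)) ⟩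
    C * sumDiv D w - C * sumDiv D w
      ≡⟨ ℤ.+-inverseʳ (C * sumDiv D w) ⟩
    0ℤ
      ∎
    where
    QD : Fin j → Div n
    QD i = Q i · D i
    term : ∀ i → Δ Γ (QD i) w ≡ C * D i w
    term i = begin
      Δ Γ (Q i · D i) w      ≡⟨ Δ-· (Q i) (D i) w ⟩
      Q i * Δ Γ (D i) w      ≡⟨ cong (_*_ (Q i)) (eigen i w) ⟩
      Q i * (c i * D i w)    ≡⟨ ℤ.*-assoc (Q i) (c i) (D i w) ⟨
      Q i * c i * D i w      ≡⟨ cong (_* D i w) (QC i) ⟩
      C * D i w              ∎

  separation : Connected Γ → ∀ {j} (D : Fin j → Div n) (c : Fin j → ℤ) → (∀ i → c i ≢ 0ℤ) →
    (∀ i w → Δ Γ (D i) w ≡ c i * D i w) →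
    (f : Div n) → (∀ w → sumDiv D w ≡ Δ Γ f w) →
    ∀ x → (∀ i → D i x ≡ 0ℤ) →
    ∀ i w → (∀ i′ → i′ ≢ i → D i′ w ≡ 0ℤ) → D i w ≡ c i * (f w - f x)
  separation conn D c c≢0 eigen f Σ≡Δf x D-at-x i w D-at-w =
    *-cancelˡ-nonzero (cofactor≢0 i) (begin
      Q i * D i w                               ≡⟨ undo-subtraction (C * f w) (Q i * D i w) ⟩
      C * f w - (C * f w - Q i * D i w)         ≡⟨ cong (_-_ (C * f w)) ψw≡ψx ⟩
      C * f w - (C * f x - 0ℤ)                  ≡⟨ factor C (f w) (f x) ⟩
      C * (f w - f x)                           ≡⟨ cong (_* (f w - f x)) (cofactor-spec i) ⟨
      Q i * c i * (f w - f x)                   ≡⟨ ℤ.*-assoc (Q i) (c i) (f w - f x) ⟩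
      Q i * (c i * (f w - f x))                 ∎)
    where
    open CommonMultiple (common-multiple c c≢0) renaming (cofactor to Q)
    ψ : Div n
    ψ = (C · f) ⊖ sumDiv (λ i → Q i · D i)
    ψ-constant : ψ w ≡ ψ x
    ψ-constant = harmonic-constant conn ψ (combination-harmonic D c eigen f Σ≡Δf C Q cofactor-spec) w x
    sum-at-w : sumDiv (λ i → Q i · D i) w ≡ Q i * D i w
    sum-at-w = sum-single _ i (λ i′ i′≢i → trans (cong (_*_ (Q i′)) (D-at-w i′ i′≢i)) (ℤ.*-zeroʳ (Q i′)))
    sum-at-x : sumDiv (λ i → Q i · D i) x ≡ 0ℤ
    sum-at-x = sum-zero (λ i′ → trans (cong (_*_ (Q i′)) (D-at-x i′)) (ℤ.*-zeroʳ (Q i′)))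
    ψw≡ψx : C * f w - Q i * D i w ≡ C * f x - 0ℤ
    ψw≡ψx = begin
      C * f w - Q i * D i w                     ≡⟨ cong (_-_ (C * f w)) sum-at-w ⟨
      ψ w                                       ≡⟨ ψ-constant ⟩
      ψ x                                       ≡⟨ cong (_-_ (C * f x)) sum-at-x ⟩
      C * f x - 0ℤ                              ∎
    undo-subtraction : ∀ a q → q ≡ a - (a - q)
    undo-subtraction = solve-∀
    factor : ∀ C p r → C * p - (C * r - 0ℤ) ≡ C * (p - r)
    factor = solve-∀

  -- A multiple a = c t of an eigen-divisor of degree zero vanishes in Pic⁰:
  -- a E = t (c E) = Δ (t E).
  eigen-multiple-in-Pic0 : ∀ {E : Div n} {a} (c t : ℤ) → (∀ w → Δ Γ E w ≡ c * E w) →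
    deg Γ E ≡ 0ℤ → a ≡ c * t → IsZeroInPic0 Γ (a · E)
  eigen-multiple-in-Pic0 {E} {a} c t eigen degE≡0 a≡ct = degree , t · E , representation
    where
    degree : deg Γ (a · E) ≡ 0ℤ
    degree = trans (sum-* a E) (trans (cong (_*_ a) degE≡0) (ℤ.*-zeroʳ a))
    rearrange : ∀ c t e → c * t * e ≡ t * (c * e)
    rearrange = solve-∀
    representation : ∀ w → (a · E) w ≡ Δ Γ (t · E) w
    representation w = begin
      a * E w          ≡⟨ cong (_* E w) a≡ct ⟩
      c * t * E w      ≡⟨ rearrange c t (E w) ⟩
      t * (c * E w)    ≡⟨ cong (_*_ t) (eigen w) ⟨
      t * Δ Γ E w      ≡⟨ Δ-· t E w ⟨
      Δ Γ (t · E) w    ∎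

-- Each block D_i = Σ_k α^i_k (v^i_0 - v^i_k) is an eigen-divisor
-- with nonzero eigenvalue c_i; separation at the outside vertex x gives
-- -α^i_k = D_i(v^i_k) = c_i (f v^i_k - f x), so α^i_k = c_i (f x - f v^i_k).
lemma3p2 : ∀ {n} (Γ : Graph n) → Connected Γ →
    (j : ℕ) → 1 ≤ j →
    (m : Fin j → ℕ) → (v : (i : Fin j) → Fin (suc (m i)) → Fin n) →
    (∀ i a b → v i a ≡ v i b → a ≡ b) →
    (∀ i i′ a b → i ≢ i′ → v i a ≢ v i′ b) →
    (∀ i → Conformity Γ (v i)) →
    (∃ λ x → ∀ i a → v i a ≢ x) →
    (α : (i : Fin j) → Fin (m i) → ℤ) →
    IsZeroInPic0 Γ (sumDiv (λ i → sumDiv (λ k → α i k · (δ (v i zero) ⊖ δ (v i (suc k)))))) →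
    ∀ i k → IsZeroInPic0 Γ (α i k · (δ (v i zero) ⊖ δ (v i (suc k))))
lemma3p2 {n} Γ conn j _ m v inj disj conf (x , x-outside) α (_ , f , Σ≡Δf) i k =
  eigen-multiple-in-Pic0 Γ (c i) (f x - f vₖ) (Δ-block-difference Γ (inj i) (conf i) k)
    (deg-δ-difference Γ (v i zero) vₖ) (negate-both-sides (c i) (f vₖ) (f x) (begin
      - α i k           ≡⟨ blockDiv-at (inj i) (α i) k ⟨
      D i vₖ            ≡⟨ separation Γ conn D c c≢0 eigen f Σ≡Δf x D-at-x i vₖ D-at-vₖ ⟩
      c i * (f vₖ - f x) ∎))
  where
  vₖ : Fin n
  vₖ = v i (suc k)
  D : Fin j → Div n
  D i = blockDiv (v i) (α i)
  c : Fin j → ℤ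
  c i = blockEigenvalue Γ (conf i)
  c≢0 : ∀ i → c i ≢ 0ℤ
  c≢0 i = blockEigenvalue-nonzero Γ (conf i) (proj₂ (has-neighbour Γ (conn (v i zero) x) (x-outside i zero)))
  eigen : ∀ i w → Δ Γ (D i) w ≡ c i * D i w
  eigen i = Δ-blockDiv Γ (inj i) (conf i) (α i)
  D-at-x : ∀ i → D i x ≡ 0ℤ
  D-at-x i = blockDiv-outside (v i) (α i) (x-outside i)
  D-at-vₖ : ∀ i′ → i′ ≢ i → D i′ vₖ ≡ 0ℤ
  D-at-vₖ i′ i′≢i = blockDiv-outside (v i′) (α i′) (λ a → disj i′ i a (suc k) i′≢i)
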